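{- Let $\widehat{H}$ be a finite weakly balanced bipartite signed graph with no purely red edges. If $\widehat H$ contains a flower $P_1, P_2, \dots, P_n$, then $\widehat{H}$ contains a chain.
   Context: A signed graph $\widehat H$ is a graph $H$ whose edges each carry the sign $+$ (blue), $-$ (red), or both (bicoloured); an edge with exactly one sign is unicoloured. Weakly balanced: every closed walk of unicoloured edges has an even number of red edges; here there are no purely red edges. Bipartite means the underlying graph $H$ is bipartite. A petal in $\widehat H$ is a pair of walks $x, l_1, l_2, \dots, l_k$ and $x, u_1, u_2, \dots, u_k$ (same starting vertex $x$, same length $k \ge 1$) such that $xl_1$ is bicoloured, $xu_1$ is unicoloured, and $l_iu_{i+1}$ is not an edge for $i = 1, \dots, k-1$; its terminal pair is $(l_k,u_k)$, with lower terminal $l_k$ and upper terminal $u_k$. A flower is a collection of petals $P_1, \dots, P_n$ such that for each $i$ (indices modulo $n$), the upper terminal of $P_i$ equals the lower terminal of $P_{i+1}$. A chain in $\widehat H$ consists of two walks of equal length, $U: u=u_0,u_1,\dots,u_k=v$ and $D: u=d_0,d_1,\dots,d_k=v$, such that the edges $uu_1$ and $d_{k-1}v$ are unicoloured, the edges $ud_1$ and $u_{k-1}v$ are bicoloured, and for each $i$ with $1\le i\le k-2$, either $u_iu_{i+1}$ and $d_id_{i+1}$ are edges of $H$ while $d_iu_{i+1}$ is not an edge of $H$, or $u_iu_{i+1}$ and $d_id_{i+1}$ are bicoloured edges while $d_iu_{i+1}$ is not a bicoloured edge. -}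

module Defs where

open import Data.Nat using (ℕ; zero; suc; _+_; _∸_; _≤_; _<_; _%_)
open import Data.Nat.Divisibility using (_∣_)
open import Data.Fin using (Fin)
open import Data.Bool using (Bool; true; false; if_then_else_)
open import Data.Product using (Σ; ∃; _×_)
open import Data.Sum using (_⊎_)
open import Relation.Nullary using (¬_)
open import Relation.Binary.PropositionalEquality using (_≡_; _≢_)

-- A finite signed graph on vertex set Fin size.  Each (unordered) pair of
-- vertices may carry the sign + (blue), the sign - (red), both, or neither.
record SignedGraph : Set where
  field
    size     : ℕ
    blue     : Fin size → Fin size → Bool
    red      : Fin size → Fin size → Bool
    blue-sym : ∀ x y → blue x y ≡ blue y x
    red-sym  : ∀ x y → red x y ≡ red y x

module _ (G : SignedGraph) where
  open SignedGraph G

  V : Set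
  V = Fin size

  Edge : V → V → Set
  Edge x y = blue x y ≡ true ⊎ red x y ≡ true

  Bicoloured : V → V → Set
  Bicoloured x y = blue x y ≡ true × red x y ≡ true

  Unicoloured : V → V → Set
  Unicoloured x y = Edge x y × ¬ Bicoloured x y

  PurelyRed : V → V → Set
  PurelyRed x y = red x y ≡ true × blue x y ≡ false

  NoPurelyRedEdges : Set
  NoPurelyRedEdges = ∀ x y → ¬ PurelyRed x y

  -- w 0, w 1, ..., w k is a walk in H (values of w beyond k are irrelevant)
  IsWalk : (ℕ → V) → ℕ → Set
  IsWalk w k = ∀ i → i < k → Edge (w i) (w (suc i))

  IsUnicolouredWalk : (ℕ → V) → ℕ → Set
  IsUnicolouredWalk w k = ∀ i → i < k → Unicoloured (w i) (w (suc i))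

  redCount : (ℕ → V) → ℕ → ℕ
  redCount w zero    = zero
  redCount w (suc k) = redCount w k + (if red (w k) (w (suc k)) then 1 else 0)

  WeaklyBalanced : Set
  WeaklyBalanced = ∀ (w : ℕ → V) (k : ℕ) → IsUnicolouredWalk w k →
                   w 0 ≡ w k → 2 ∣ redCount w k

  Bipartite : Set
  Bipartite = Σ (V → Bool) λ c → ∀ x y → Edge x y → c x ≢ c y

  record Petal : Set where
    field
      k     : ℕ
      1≤k   : 1 ≤ k
      x     : V
      l u   : ℕ → V
      l0    : l 0 ≡ x
      u0    : u 0 ≡ x
      l-walk : IsWalk l k
      u-walk : IsWalk u k
      xl₁   : Bicoloured x (l 1)
      xu₁   : Unicoloured x (u 1)
      nonadj : ∀ i → 1 ≤ i → i < k → ¬ Edge (l i) (u (suc i))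

    lower upper : V
    lower = l k
    upper = u k

  -- flower: petals P 0, ..., P (suc m ∸ 1) (n = suc m ≥ 1 petals), where
  -- the upper terminal of P i is the lower terminal of P (i+1 mod n)
  Flower : Set
  Flower = Σ ℕ λ m → Σ (ℕ → Petal) λ P →
           ∀ i → i < suc m → Petal.upper (P i) ≡ Petal.lower (P (suc i % suc m))

  record Chain : Set where
    field
      k      : ℕ
      1≤k    : 1 ≤ k
      U D    : ℕ → V
      start  : U 0 ≡ D 0
      end    : U k ≡ D k
      U-walk : IsWalk U k
      D-walk : IsWalk D k
      uu₁    : Unicoloured (U 0) (U 1)
      dv     : Unicoloured (D (k ∸ 1)) (D k)
      ud₁    : Bicoloured (D 0) (D 1)
      uv     : Bicoloured (U (k ∸ 1)) (U k)
      middle : ∀ i → 1 ≤ i → suc (suc i) ≤ k →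
               (Edge (U i) (U (suc i)) × Edge (D i) (D (suc i)) × ¬ Edge (D i) (U (suc i)))
               ⊎ (Bicoloured (U i) (U (suc i)) × Bicoloured (D i) (D (suc i))
                  × ¬ Bicoloured (D i) (U (suc i)))

-- Call (d , u) a terminal pair if it is the terminal pair of some petal.  Terminal pairs
-- compose: given terminal pairs (a , b) and (b , c), either (a , c) is a terminal pair, or
-- some pair and its reverse are both terminal pairs.  A petal ending in (d , u),
-- followed by the walks of a petal ending in (u , d) traversed backwards, is a chain.  Going
-- once round a flower therefore either produces a chain on the way or ends with a terminal
-- pair (a , a), which is a chain together with itself.
module Submission where

open import Defs
open import Data.Nat using (ℕ; zero; suc; _≤_; _<_; _%_; z≤n; s≤s)
open import Data.Nat.Properties using (<⇒≤; ≤-refl; m<n⇒m<1+n)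
open import Data.Nat.DivMod using (m<n⇒m%n≡m; n%n≡0)
open import Data.Bool using (true)
open import Data.Bool.Properties using () renaming (_≟_ to _≟ᴮ_)
open import Data.Product using (Σ; _,_; proj₁; proj₂)
open import Data.Sum using (_⊎_; inj₁; inj₂)
open import Function using (_∘_)
open import Relation.Nullary using (¬_; Dec; yes; no)
open import Relation.Nullary.Decidable using (_⊎-dec_; _×-dec_)
open import Relation.Binary.PropositionalEquality using (_≡_; refl; trans; subst)

module _ (G : SignedGraph) where
  open SignedGraph G

  Edge-sym : ∀ {x y} → Edge G x y → Edge G y x
  Edge-sym {x} {y} (inj₁ b) = inj₁ (trans (blue-sym y x) b)
  Edge-sym {x} {y} (inj₂ r) = inj₂ (trans (red-sym y x) r)

  Bicoloured-sym : ∀ {x y} → Bicoloured G x y → Bicoloured G y x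
  Bicoloured-sym {x} {y} (b , r) = trans (blue-sym y x) b , trans (red-sym y x) r

  Unicoloured-sym : ∀ {x y} → Unicoloured G x y → Unicoloured G y x
  Unicoloured-sym (e , ¬bi) = Edge-sym e , ¬bi ∘ Bicoloured-sym

  Bicoloured⇒Edge : ∀ {x y} → Bicoloured G x y → Edge G x y
  Bicoloured⇒Edge (b , _) = inj₁ b

  Edge? : ∀ x y → Dec (Edge G x y)
  Edge? x y = (blue x y ≟ᴮ true) ⊎-dec (red x y ≟ᴮ true)

  Bicoloured? : ∀ x y → Dec (Bicoloured G x y)
  Bicoloured? x y = (blue x y ≟ᴮ true) ×-dec (red x y ≟ᴮ true)

  data TerminalPair : V G → V G → Set where
    base   : ∀ x {d u} → Bicoloured G x d → Unicoloured G x u → TerminalPair d u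
    extend : ∀ {d u d′ u′} → TerminalPair d u →
             Edge G d d′ → Edge G u u′ → ¬ Edge G d u′ → TerminalPair d′ u′

  petal-terminalPair : (P : Petal G) → TerminalPair (Petal.lower P) (Petal.upper P)
  petal-terminalPair P = prefix k 1≤k ≤-refl
    where
    open Petal P
    prefix : ∀ j → 1 ≤ j → j ≤ k → TerminalPair (l j) (u j)
    prefix 1 _ _ = base x xl₁ xu₁
    prefix (suc (suc j)) _ j+2≤k =
      extend (prefix (suc j) (s≤s z≤n) (<⇒≤ j+2≤k))
             (l-walk (suc j) j+2≤k) (u-walk (suc j) j+2≤k) (nonadj (suc j) (s≤s z≤n) j+2≤k)

  predecessor : ∀ {d u} → TerminalPair d u → V G
  predecessor (base x _ _)          = x
  predecessor (extend {d} _ _ _ _) = d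

  predecessor-edge : ∀ {d u} (r : TerminalPair d u) → Edge G (predecessor r) d
  predecessor-edge (base _ xd _)     = Bicoloured⇒Edge xd
  predecessor-edge (extend _ e _ _) = e

  -- Redirect the last lower edge to c (the non-adjacency condition is the old one), unless
  -- the walk has length one and xc is unicoloured; then xc becomes the new first upper edge.
  pivot : ∀ {d u c} (r : TerminalPair d u) → Edge G (predecessor r) c →
          TerminalPair c u ⊎ TerminalPair d c
  pivot {c = c} (base x xd xu) xc with Bicoloured? x c
  ... | yes xc-bi = inj₁ (base x xc-bi xu)
  ... | no ¬xc-bi = inj₂ (base x xd (xc , ¬xc-bi))
  pivot (extend r _ uu′ ¬du′) dc = inj₁ (extend r dc uu′ ¬du′)

  -- The end of a chain from a pair (D i , U i) = (d , u) on, of length n + 1.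
  data ChainTail : V G → V G → ℕ → Set where
    meet : ∀ {d u} v → Unicoloured G d v → Bicoloured G u v → ChainTail d u 0
    step : ∀ {d u d′ u′ n} → Edge G d d′ → Edge G u u′ → ¬ Edge G d u′ →
           ChainTail d′ u′ n → ChainTail d u (suc n)

  lowerWalk : ∀ {d u n} → ChainTail d u n → ℕ → V G
  lowerWalk {d} t zero             = d
  lowerWalk (meet v _ _) (suc i)   = v
  lowerWalk (step _ _ _ t) (suc i) = lowerWalk t i

  upperWalk : ∀ {d u n} → ChainTail d u n → ℕ → V G
  upperWalk {u = u} t zero         = u
  upperWalk (meet v _ _) (suc i)   = v
  upperWalk (step _ _ _ t) (suc i) = upperWalk t i

  lowerWalk-edge : ∀ {d u n} (t : ChainTail d u n) i → i ≤ n →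
                   Edge G (lowerWalk t i) (lowerWalk t (suc i))
  lowerWalk-edge (meet _ dv _) zero _          = proj₁ dv
  lowerWalk-edge (step e _ _ _) zero _         = e
  lowerWalk-edge (step _ _ _ t) (suc i) (s≤s p) = lowerWalk-edge t i p

  upperWalk-edge : ∀ {d u n} (t : ChainTail d u n) i → i ≤ n →
                   Edge G (upperWalk t i) (upperWalk t (suc i))
  upperWalk-edge (meet _ _ uv) zero _          = Bicoloured⇒Edge uv
  upperWalk-edge (step _ e _ _) zero _         = e
  upperWalk-edge (step _ _ _ t) (suc i) (s≤s p) = upperWalk-edge t i p

  walks-nonadjacent : ∀ {d u n} (t : ChainTail d u n) i → i < n →
                      ¬ Edge G (lowerWalk t i) (upperWalk t (suc i))
  walks-nonadjacent (step _ _ ne _) zero _          = ne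
  walks-nonadjacent (step _ _ _ t) (suc i) (s≤s p) = walks-nonadjacent t i p

  lowerWalk-last : ∀ {d u n} (t : ChainTail d u n) →
                   Unicoloured G (lowerWalk t n) (lowerWalk t (suc n))
  lowerWalk-last (meet _ dv _)  = dv
  lowerWalk-last (step _ _ _ t) = lowerWalk-last t

  upperWalk-last : ∀ {d u n} (t : ChainTail d u n) →
                   Bicoloured G (upperWalk t n) (upperWalk t (suc n))
  upperWalk-last (meet _ _ uv)  = uv
  upperWalk-last (step _ _ _ t) = upperWalk-last t

  walks-meet : ∀ {d u n} (t : ChainTail d u n) → upperWalk t (suc n) ≡ lowerWalk t (suc n)
  walks-meet (meet _ _ _)   = refl
  walks-meet (step _ _ _ t) = walks-meet t

  chain-from : ∀ {x d u n} → Bicoloured G x d → Unicoloured G x u → ChainTail d u n → Chain G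
  chain-from {x} {n = n} xd xu t = record
    { k      = suc (suc n)
    ; 1≤k    = s≤s z≤n
    ; U      = U
    ; D      = D
    ; start  = refl
    ; end    = walks-meet t
    ; U-walk = U-walk
    ; D-walk = D-walk
    ; uu₁    = xu
    ; dv     = lowerWalk-last t
    ; ud₁    = xd
    ; uv     = upperWalk-last t
    ; middle = λ { (suc i) _ (s≤s (s≤s i<n)) →
                   inj₁ ( upperWalk-edge t i (<⇒≤ i<n)
                        , lowerWalk-edge t i (<⇒≤ i<n)
                        , walks-nonadjacent t i i<n ) }
    }
    where
    U D : ℕ → V G
    U zero    = x
    U (suc i) = upperWalk t i
    D zero    = x
    D (suc i) = lowerWalk t i

    U-walk : IsWalk G U (suc (suc n))
    U-walk zero _                   = proj₁ xu
    U-walk (suc i) (s≤s (s≤s i≤n)) = upperWalk-edge t i i≤n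

    D-walk : IsWalk G D (suc (suc n))
    D-walk zero _                   = Bicoloured⇒Edge xd
    D-walk (suc i) (s≤s (s≤s i≤n)) = lowerWalk-edge t i i≤n

  reverse : ∀ {d u} → TerminalPair u d → Σ ℕ (ChainTail d u)
  reverse (base x xu xd) = 0 , meet x (Unicoloured-sym xd) (Bicoloured-sym xu)
  reverse (extend r uu′ dd′ ¬ud′) =
    let n , t = reverse r in suc n , step (Edge-sym dd′) (Edge-sym uu′) (¬ud′ ∘ Edge-sym) t

  prepend : ∀ {d u n} → TerminalPair d u → ChainTail d u n → Chain G
  prepend (base x xd xu) t          = chain-from xd xu t
  prepend (extend r dd′ uu′ ¬du′) t = prepend r (step dd′ uu′ ¬du′ t)

  chain : ∀ {d u} → TerminalPair d u → TerminalPair u d → Chain G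
  chain du ud = prepend du (proj₂ (reverse ud))

  -- Given a terminal pair (p , w) reached by stepping back from (a , b), where p is the
  -- predecessor of a, and an edge wc: step forward to (a , c) unless pc is an edge, in
  -- which case pivot (a , b) at c.
  close : ∀ {a b c w} (ab : TerminalPair a b) → TerminalPair b c →
          TerminalPair (predecessor ab) w → Edge G w c → TerminalPair a c ⊎ Chain G
  close {c = c} ab bc pw wc with Edge? (predecessor ab) c
  ... | no ¬pc = inj₁ (extend pw (predecessor-edge ab) wc ¬pc)
  ... | yes pc with pivot ab pc
  ...   | inj₁ cb = inj₂ (chain cb bc)
  ...   | inj₂ ac = inj₁ ac

  compose : ∀ {a b c} → TerminalPair a b → TerminalPair b c → TerminalPair a c ⊎ Chain G
  compose {a} ab bc with Edge? (predecessor bc) a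
  ... | yes qa with pivot bc qa
  ...   | inj₁ ac = inj₁ ac
  ...   | inj₂ ba = inj₂ (chain ab ba)
  compose ab bc | no ¬qa = compose-back ab bc
    (extend ab (Edge-sym (predecessor-edge ab)) (Edge-sym (predecessor-edge bc)) (¬qa ∘ Edge-sym))
    where
    compose-back : ∀ {a b c} (ab : TerminalPair a b) (bc : TerminalPair b c) →
                   TerminalPair (predecessor ab) (predecessor bc) → TerminalPair a c ⊎ Chain G
    compose-back ab bc@(base _ _ yc) py = close ab bc py (proj₁ yc)
    compose-back ab bc@(extend b′c′ _ c′c _) pb′ with compose pb′ b′c′
    ... | inj₁ pc′ = close ab bc pc′ c′c
    ... | inj₂ ch  = inj₂ ch

  chain-from-cycle : (a : ℕ → V G) (n : ℕ) → (∀ i → i < n → TerminalPair (a i) (a (suc i))) →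
                     TerminalPair (a n) (a 0) → Chain G
  chain-from-cycle a zero _ closing = chain closing closing
  chain-from-cycle a (suc n) links closing with compose (links n ≤-refl) closing
  ... | inj₁ r  = chain-from-cycle a n (λ i i<n → links i (m<n⇒m<1+n i<n)) r
  ... | inj₂ ch = ch

  flower-chain : Flower G → Chain G
  flower-chain (m , P , upper≡lower) = chain-from-cycle lowerTerminal m link closing
    where
    lowerTerminal : ℕ → V G
    lowerTerminal i = Petal.lower (P i)

    petal-link : ∀ i → i < suc m → TerminalPair (lowerTerminal i) (lowerTerminal (suc i % suc m))
    petal-link i i≤m = subst (TerminalPair _) (upper≡lower i i≤m) (petal-terminalPair (P i))

    link : ∀ i → i < m → TerminalPair (lowerTerminal i) (lowerTerminal (suc i))
    link i i<m = subst (λ j → TerminalPair (lowerTerminal i) (lowerTerminal j))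
                       (m<n⇒m%n≡m (s≤s i<m)) (petal-link i (m<n⇒m<1+n i<m))

    closing : TerminalPair (lowerTerminal m) (lowerTerminal 0)
    closing = subst (λ j → TerminalPair (lowerTerminal m) (lowerTerminal j))
                    (n%n≡0 (suc m)) (petal-link m ≤-refl)

lemma1 : (G : SignedGraph) → WeaklyBalanced G → NoPurelyRedEdges G → Bipartite G →
    Flower G → Chain G
lemma1 G _ _ _ = flower-chain G
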